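{- Let $\mathcal{T} = \{(*_1),\dots,(*_t)\}$ be a valid collection of $t$ linearly independent difference equalities in $x_1,\dots,x_k$, and suppose $\mathcal{T}$ minimally implies a difference equality $(*_{\mathcal{T}})$. Then: (i) at most $2t+2$ variables appear in $\mathcal{T}$, and if exactly $2t+2$ do, then every variable appearing in $\mathcal{T}$ appears in exactly two of the equations $(*_1),\dots,(*_t),(*_{\mathcal{T}})$; (ii) for every proper subset $\mathcal{T}' \subsetneq \mathcal{T}$ of size $t'$, at most $2t'$ variables appear in $\mathcal{T}'$ but not in $\mathcal{T} \setminus \mathcal{T}'$.
   Context: A difference equality in $x_1,\dots,x_k$ is a linear equation over $\mathbb{R}$ of the form $x_{i_1} - x_{i_2} - x_{i_3} + x_{i_4} = 0$ with $i_1,\dots,i_4 \in \{1,\dots,k\}$ not necessarily distinct and $\{i_1,i_4\} \neq \{i_2,i_3\}$. The content of an equation $E = 0$ is the linear form $E$. Equations are linearly independent if their contents are. A collection $\mathcal{T}$ implies an equation if its content is a linear combination of the contents of the equations in $\mathcal{T}$; $\mathcal{T}$ minimally implies it if $\mathcal{T}$ implies it but no proper subset of $\mathcal{T}$ does. A variable $x_j$ appears in an equation if its coefficient there is nonzero, and appears in a collection if it appears in some equation of it. A collection is valid if it does not imply $x_a - x_b = 0$ for any $a \neq b$. -}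

module Defs where

open import Data.Nat using (ℕ; zero; suc)
open import Data.Fin using (Fin; zero; suc)
import Data.Fin as F
open import Data.Fin.Subset using (Subset; _∈_; _∉_; inside; outside)
open import Data.Bool using (Bool; true; false; if_then_else_; _∧_; _∨_; not)
open import Data.Vec using (lookup; tabulate)
open import Data.Rational using (ℚ; 0ℚ; 1ℚ; _+_; _*_; _-_)
import Data.Rational.Properties as ℚP
open import Data.Product using (Σ; ∃; _×_; _,_)
open import Data.Sum using (_⊎_)
open import Relation.Nullary using (¬_; does)
open import Relation.Binary.PropositionalEquality using (_≡_; _≢_)
open import Function.Bundles using (_⇔_)

-- Variables x_1..x_k are indexed by Fin k; a linear form is its coefficient vector.
LinForm : ℕ → Set
LinForm k = Fin k → ℚ

SameSet : ∀ {k} → Fin k → Fin k → Fin k → Fin k → Set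
SameSet a b c d = ∀ x → ((x ≡ a) ⊎ (x ≡ b)) ⇔ ((x ≡ c) ⊎ (x ≡ d))

-- The difference equality x_{i1} - x_{i2} - x_{i3} + x_{i4} = 0
record DiffEq (k : ℕ) : Set where
  constructor diffEq
  field
    i₁ i₂ i₃ i₄ : Fin k
    nondeg : ¬ SameSet i₁ i₄ i₂ i₃

unit : ∀ {k} → Fin k → LinForm k
unit a j = if does (j F.≟ a) then 1ℚ else 0ℚ

content : ∀ {k} → DiffEq k → LinForm k
content e j = unit (DiffEq.i₁ e) j - unit (DiffEq.i₂ e) j
              - unit (DiffEq.i₃ e) j + unit (DiffEq.i₄ e) j

sumFin : ∀ n → (Fin n → ℚ) → ℚ
sumFin zero    f = 0ℚ
sumFin (suc n) f = f zero + sumFin n (λ i → f (suc i))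

lincomb : ∀ {k t} → (Fin t → DiffEq k) → (Fin t → ℚ) → LinForm k
lincomb {t = t} 𝒯 c j = sumFin t (λ i → c i * content (𝒯 i) j)

ImpliesForm : ∀ {k t} → (Fin t → DiffEq k) → Subset t → LinForm k → Set
ImpliesForm 𝒯 S f =
  Σ (_ → ℚ) λ c → (∀ i → i ∉ S → c i ≡ 0ℚ) × (∀ j → lincomb 𝒯 c j ≡ f j)

Implies : ∀ {k t} → (Fin t → DiffEq k) → Subset t → DiffEq k → Set
Implies 𝒯 S E = ImpliesForm 𝒯 S (content E)

LinIndep : ∀ {k t} → (Fin t → DiffEq k) → Set
LinIndep 𝒯 = ∀ c → (∀ j → lincomb 𝒯 c j ≡ 0ℚ) → ∀ i → c i ≡ 0ℚ

Valid : ∀ {k t} → (Fin t → DiffEq k) → Set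
Valid {k} 𝒯 = ∀ (a b : Fin k) → a ≢ b →
  ¬ ImpliesForm 𝒯 Data.Fin.Subset.⊤ (λ j → unit a j - unit b j)

MinImplies : ∀ {k t} → (Fin t → DiffEq k) → DiffEq k → Set
MinImplies 𝒯 E = Implies 𝒯 Data.Fin.Subset.⊤ E ×
  (∀ S → S Data.Fin.Subset.⊂ Data.Fin.Subset.⊤ → ¬ Implies 𝒯 S E)

appearsB : ∀ {k} → Fin k → DiffEq k → Bool
appearsB j e = not (does (content e j ℚP.≟ 0ℚ))

appearsInB : ∀ {k t} → (Fin t → DiffEq k) → Subset t → Fin k → Bool
appearsInB {t = zero}  𝒯 S j = false
appearsInB {t = suc t} 𝒯 S j =
  (isIn (lookup S zero) ∧ appearsB j (𝒯 zero))
  ∨ appearsInB (λ i → 𝒯 (suc i)) (tabulate (λ i → lookup S (suc i))) j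
  where
  isIn : Data.Fin.Subset.Side → Bool
  isIn b = b

varsIn : ∀ {k t} → (Fin t → DiffEq k) → Subset t → Subset k
varsIn 𝒯 S = tabulate (appearsInB 𝒯 S)

varsOnlyIn : ∀ {k t} → (Fin t → DiffEq k) → Subset t → Subset k
varsOnlyIn 𝒯 S =
  tabulate (λ j → appearsInB 𝒯 S j ∧ not (appearsInB 𝒯 (Data.Fin.Subset.∁ S) j))

countB : ∀ n → (Fin n → Bool) → ℕ
countB zero    b = 0
countB (suc n) b = (if b zero then 1 else 0) Data.Nat.+ countB n (λ i → b (suc i))

occurrences : ∀ {k t} → (Fin t → DiffEq k) → DiffEq k → Fin k → ℕ
occurrences {t = t} 𝒯 E j =
  countB (suc t) (λ { zero → appearsB j E ; (suc i) → appearsB j (𝒯 i) })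

module Submission where

-- Write the content of (*_𝒯) as Σ cᵢ (*_i); minimality forces every cᵢ ≠ 0. A variable of 𝒯 lying
-- in only one of (*_1),…,(*_t),(*_𝒯) would have a nonzero coefficient on exactly one side of this
-- identity, so every variable of 𝒯 lies in at least two of these t + 1 equations, each of which has
-- at most four variables: hence 2·|vars 𝒯| ≤ 4(t + 1), with equality only if every variable lies in
-- exactly two. For (ii), the part Σ_{i ∉ 𝒯′} cᵢ (*_i) is a nonzero form (independence) whose
-- coefficients sum to zero, so by validity it involves at least three variables, each shared by 𝒯′
-- and 𝒯 ∖ 𝒯′ or lying in (*_𝒯) but not only in 𝒯′. A variable only in 𝒯′ lies in two equations of 𝒯′
-- or in one of them and in (*_𝒯); double counting the at most 4t′ incidences of 𝒯′ against these
-- three variables and the at most four of (*_𝒯) gives 2·|only 𝒯′| ≤ 4t′ + 1.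

open import Data.Fin using (Fin; zero; suc; _≟_)
import Data.Fin.Properties as FinP
open import Data.Fin.Subset using (Subset; _∈_; _∉_; _⊂_; ⊤; ∣_∣; ∁; ⁅_⁆)
open import Data.Fin.Subset.Properties using (∈⊤; ∣⊤∣≡n; x∈⁅x⁆; x∈⁅y⁆⇒x≡y; x∈p⇒x∉∁p; x∉∁p⇒x∈p)
open import Data.Vec using ([]; _∷_; lookup; tabulate)
open import Data.Vec.Properties using (lookup∘tabulate; lookup-replicate; lookup-map; []=⇒lookup; lookup⇒[]=)
open import Data.Bool using (Bool; true; false; if_then_else_; _∧_; _∨_; not)
import Data.Bool.Properties as BoolP
open import Data.Product using (∃; _×_; _,_)
open import Data.Sum using (_⊎_; inj₁; inj₂)
open import Data.Empty using (⊥-elim)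
open import Function using (_∘_)
open import Relation.Nullary using (¬_; Dec; does; yes; no)
open import Relation.Nullary.Decidable using (dec-true; dec-false)
open import Relation.Binary.PropositionalEquality
import Algebra.Properties.Semiring.Sum as SemiringSum
open import Data.Rational as ℚ using (ℚ; 0ℚ)
open import Defs

module Counting where

  open import Data.Nat using (ℕ; zero; suc; _+_; _≤_; _<_; z≤n; s≤s)
  import Data.Nat.Properties as ℕP

  module ℕΣ = SemiringSum ℕP.+-*-semiring

  ∑-mono-≤ : ∀ {n} {f g : Fin n → ℕ} → (∀ i → f i ≤ g i) → ℕΣ.sum f ≤ ℕΣ.sum g
  ∑-mono-≤ {zero}  f≤g = z≤n
  ∑-mono-≤ {suc n} f≤g = ℕP.+-mono-≤ (f≤g zero) (∑-mono-≤ (f≤g ∘ suc))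

  ∑-mono-< : ∀ {n} {f g : Fin n → ℕ} → (∀ i → f i ≤ g i) → ∀ j → f j < g j → ℕΣ.sum f < ℕΣ.sum g
  ∑-mono-< f≤g zero    fj<gj = ℕP.+-mono-<-≤ fj<gj (∑-mono-≤ (f≤g ∘ suc))
  ∑-mono-< f≤g (suc j) fj<gj = ℕP.+-mono-≤-< (f≤g zero) (∑-mono-< (f≤g ∘ suc) j fj<gj)

  ∑-tight : ∀ {n} {f g : Fin n → ℕ} → (∀ i → f i ≤ g i) → ℕΣ.sum g ≤ ℕΣ.sum f → ∀ i → f i ≡ g i
  ∑-tight f≤g ∑g≤∑f i with ℕP.m≤n⇒m<n∨m≡n (f≤g i)
  ... | inj₁ fi<gi = ⊥-elim (ℕP.<⇒≱ (∑-mono-< f≤g i fi<gi) ∑g≤∑f)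
  ... | inj₂ fi≡gi = fi≡gi

  𝟙 : Bool → ℕ
  𝟙 b = if b then 1 else 0

  countB≡∑ : ∀ n (b : Fin n → Bool) → countB n b ≡ ℕΣ.sum (𝟙 ∘ b)
  countB≡∑ zero    b = refl
  countB≡∑ (suc n) b = cong (𝟙 (b zero) +_) (countB≡∑ n (b ∘ suc))

  countB-cong : ∀ {n} {b b′ : Fin n → Bool} → (∀ i → b i ≡ b′ i) → countB n b ≡ countB n b′
  countB-cong {zero}  b≗b′ = refl
  countB-cong {suc n} b≗b′ = cong₂ _+_ (cong 𝟙 (b≗b′ zero)) (countB-cong (b≗b′ ∘ suc))

  countB-false : ∀ n → countB n (λ _ → false) ≡ 0
  countB-false zero    = refl
  countB-false (suc n) = countB-false n

  countB-mono : ∀ {n} {b b′ : Fin n → Bool} → (∀ i → b i ≡ true → b′ i ≡ true) → countB n b ≤ countB n b′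
  countB-mono {zero}  b⇒b′ = z≤n
  countB-mono {suc n} {b} b⇒b′ = ℕP.+-mono-≤ (𝟙-mono (b zero) (b⇒b′ zero)) (countB-mono (b⇒b′ ∘ suc))
    where
    𝟙-mono : ∀ x {y} → (x ≡ true → y ≡ true) → 𝟙 x ≤ 𝟙 y
    𝟙-mono false x⇒y = z≤n
    𝟙-mono true  x⇒y rewrite x⇒y refl = ℕP.≤-refl

  countB-∨ : ∀ n (b b′ : Fin n → Bool) → countB n (λ i → b i ∨ b′ i) ≤ countB n b + countB n b′
  countB-∨ n b b′ = begin
    countB n (λ i → b i ∨ b′ i)             ≡⟨ countB≡∑ n _ ⟩
    ℕΣ.sum (λ i → 𝟙 (b i ∨ b′ i))           ≤⟨ ∑-mono-≤ (λ i → 𝟙-∨ (b i) (b′ i)) ⟩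
    ℕΣ.sum (λ i → 𝟙 (b i) + 𝟙 (b′ i))       ≡⟨ ℕΣ.∑-distrib-+ (𝟙 ∘ b) (𝟙 ∘ b′) ⟩
    ℕΣ.sum (𝟙 ∘ b) + ℕΣ.sum (𝟙 ∘ b′)        ≡⟨ sym (cong₂ _+_ (countB≡∑ n b) (countB≡∑ n b′)) ⟩
    countB n b + countB n b′                ∎
    where
    open ℕP.≤-Reasoning
    𝟙-∨ : ∀ x y → 𝟙 (x ∨ y) ≤ 𝟙 x + 𝟙 y
    𝟙-∨ false y     = ℕP.≤-refl
    𝟙-∨ true  false = ℕP.≤-refl
    𝟙-∨ true  true  = s≤s z≤n

  countB-split : ∀ n (p b : Fin n → Bool) →
    countB n b ≡ countB n (λ i → p i ∧ b i) + countB n (λ i → not (p i) ∧ b i)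
  countB-split n p b = begin
    countB n b                                                   ≡⟨ countB≡∑ n b ⟩
    ℕΣ.sum (𝟙 ∘ b)                                               ≡⟨ ℕΣ.sum-cong-≗ (λ i → 𝟙-split (p i) (b i)) ⟩
    ℕΣ.sum (λ i → 𝟙 (p i ∧ b i) + 𝟙 (not (p i) ∧ b i))
      ≡⟨ ℕΣ.∑-distrib-+ (λ i → 𝟙 (p i ∧ b i)) (λ i → 𝟙 (not (p i) ∧ b i)) ⟩
    ℕΣ.sum (λ i → 𝟙 (p i ∧ b i)) + ℕΣ.sum (λ i → 𝟙 (not (p i) ∧ b i))
      ≡⟨ sym (cong₂ _+_ (countB≡∑ n _) (countB≡∑ n _)) ⟩
    countB n (λ i → p i ∧ b i) + countB n (λ i → not (p i) ∧ b i) ∎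
    where
    open ≡-Reasoning
    𝟙-split : ∀ x y → 𝟙 y ≡ 𝟙 (x ∧ y) + 𝟙 (not x ∧ y)
    𝟙-split false false = refl
    𝟙-split false true  = refl
    𝟙-split true  false = refl
    𝟙-split true  true  = refl

  countB-remove : ∀ n (b : Fin n → Bool) {x} → b x ≡ true →
    countB n b ≡ suc (countB n (λ j → b j ∧ not (does (j ≟ x))))
  countB-remove (suc n) b {zero} bx rewrite bx =
    cong suc (countB-cong (λ j → sym (BoolP.∧-identityʳ (b (suc j)))))
  countB-remove (suc n) b {suc x} bx = begin
    𝟙 (b zero) + countB n (b ∘ suc)        ≡⟨ cong (𝟙 (b zero) +_) (countB-remove n (b ∘ suc) bx) ⟩
    𝟙 (b zero) + suc rest                  ≡⟨ ℕP.+-suc (𝟙 (b zero)) rest ⟩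
    suc (𝟙 (b zero) + rest)                ≡⟨ cong (λ y → suc (𝟙 y + rest)) (BoolP.∧-identityʳ (b zero)) ⟨
    suc (𝟙 (b zero ∧ true) + rest)         ∎
    where
    open ≡-Reasoning
    rest : ℕ
    rest = countB n (λ j → b (suc j) ∧ not (does (j ≟ x)))

  countB-≥1 : ∀ n (b : Fin n → Bool) {x} → b x ≡ true → 1 ≤ countB n b
  countB-≥1 n b bx rewrite countB-remove n b bx = s≤s z≤n

  private
    removal-keeps : ∀ {n} (b : Fin n → Bool) {x y} → y ≢ x → b y ≡ true → (b y ∧ not (does (y ≟ x))) ≡ true
    removal-keeps b {x} {y} y≢x by rewrite by | dec-false (y ≟ x) y≢x = refl

  countB-≥2 : ∀ n (b : Fin n → Bool) {x y} → y ≢ x → b x ≡ true → b y ≡ true → 2 ≤ countB n b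
  countB-≥2 n b y≢x bx by rewrite countB-remove n b bx = s≤s (countB-≥1 n _ (removal-keeps b y≢x by))

  countB-≥3 : ∀ n (b : Fin n → Bool) {x y z} → y ≢ x → z ≢ x → z ≢ y →
    b x ≡ true → b y ≡ true → b z ≡ true → 3 ≤ countB n b
  countB-≥3 n b y≢x z≢x z≢y bx by bz rewrite countB-remove n b bx =
    s≤s (countB-≥2 n _ z≢y (removal-keeps b y≢x by) (removal-keeps b z≢x bz))

  countB-≟ : ∀ n (x : Fin n) → countB n (λ j → does (j ≟ x)) ≡ 1
  countB-≟ n x = begin
    countB n (λ j → does (j ≟ x))                           ≡⟨ countB-remove n _ (dec-true (x ≟ x) refl) ⟩
    suc (countB n (λ j → does (j ≟ x) ∧ not (does (j ≟ x)))) ≡⟨ cong suc (countB-cong (λ j → BoolP.∧-inverseʳ (does (j ≟ x)))) ⟩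
    suc (countB n (λ _ → false))                            ≡⟨ cong suc (countB-false n) ⟩
    1                                                       ∎
    where open ≡-Reasoning

module LinearForms where

  open import Data.Nat using (zero; suc; _≤?_) renaming (_≤_ to _≤ℕ_)
  open import Data.Rational using (ℚ; 0ℚ; 1ℚ; _+_; _*_; _-_; -_; 1/_; ≢-nonZero)
  import Data.Rational.Properties as ℚP
  open import Relation.Nullary.Decidable using (¬?; decidable-stable; _×-dec_)
  open import Algebra.Bundles using (CommutativeRing)
  open import Algebra.Properties.Group ℚP.+-0-group using (inverseʳ-unique)
  open Counting

  module ℚΣ = SemiringSum (CommutativeRing.semiring ℚP.+-*-commutativeRing)

  nonzero? : ℚ → Bool
  nonzero? q = not (does (q ℚP.≟ 0ℚ))

  nonzero?-sound : ∀ {q} → nonzero? q ≡ true → q ≢ 0ℚ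
  nonzero?-sound {q} nz q≡0 with () ← trans (sym nz) (cong not (dec-true (q ℚP.≟ 0ℚ) q≡0))

  nonzero?-complete : ∀ {q} → q ≢ 0ℚ → nonzero? q ≡ true
  nonzero?-complete {q} q≢0 = cong not (dec-false (q ℚP.≟ 0ℚ) q≢0)

  nonzero?-false : ∀ {q} → nonzero? q ≡ false → q ≡ 0ℚ
  nonzero?-false {q} z with q ℚP.≟ 0ℚ
  nonzero?-false {q} z  | yes q≡0 = q≡0
  nonzero?-false {q} () | no _

  *-≢0 : ∀ {p q} → p ≢ 0ℚ → q ≢ 0ℚ → p * q ≢ 0ℚ
  *-≢0 {p} {q} p≢0 q≢0 pq≡0 = q≢0 (begin
    q              ≡⟨ ℚP.*-identityˡ q ⟨
    1ℚ * q         ≡⟨ cong (_* q) (ℚP.*-inverseˡ p {{≢-nonZero p≢0}}) ⟨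
    p⁻¹ * p * q    ≡⟨ ℚP.*-assoc p⁻¹ p q ⟩
    p⁻¹ * (p * q)  ≡⟨ cong (p⁻¹ *_) pq≡0 ⟩
    p⁻¹ * 0ℚ       ≡⟨ ℚP.*-zeroʳ p⁻¹ ⟩
    0ℚ             ∎)
    where
    open ≡-Reasoning
    p⁻¹ : ℚ
    p⁻¹ = (1/ p) {{≢-nonZero p≢0}}

  sumFin≡∑ : ∀ n (f : Fin n → ℚ) → sumFin n f ≡ ℚΣ.sum f
  sumFin≡∑ zero    f = refl
  sumFin≡∑ (suc n) f = cong (f zero +_) (sumFin≡∑ n (f ∘ suc))

  sumFin-cong : ∀ n {f g : Fin n → ℚ} → (∀ i → f i ≡ g i) → sumFin n f ≡ sumFin n g
  sumFin-cong zero    f≗g = refl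
  sumFin-cong (suc n) f≗g = cong₂ _+_ (f≗g zero) (sumFin-cong n (f≗g ∘ suc))

  sumFin-zero : ∀ n {f : Fin n → ℚ} → (∀ i → f i ≡ 0ℚ) → sumFin n f ≡ 0ℚ
  sumFin-zero zero    f≗0 = refl
  sumFin-zero (suc n) f≗0 = cong₂ _+_ (f≗0 zero) (sumFin-zero n (f≗0 ∘ suc))

  sumFin-supportedAt : ∀ n {f : Fin n → ℚ} i₀ → (∀ i → i ≢ i₀ → f i ≡ 0ℚ) → sumFin n f ≡ f i₀
  sumFin-supportedAt (suc n) {f} zero f≗0 =
    trans (cong (f zero +_) (sumFin-zero n (λ i → f≗0 (suc i) λ ()))) (ℚP.+-identityʳ (f zero))
  sumFin-supportedAt (suc n) {f} (suc i₀) f≗0 =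
    trans (cong₂ _+_ (f≗0 zero λ ()) (sumFin-supportedAt n i₀ (λ i i≢i₀ → f≗0 (suc i) (i≢i₀ ∘ FinP.suc-injective))))
          (ℚP.+-identityˡ (f (suc i₀)))

  sumFin-+ : ∀ n (f g : Fin n → ℚ) → sumFin n (λ i → f i + g i) ≡ sumFin n f + sumFin n g
  sumFin-+ n f g = begin
    sumFin n (λ i → f i + g i) ≡⟨ sumFin≡∑ n _ ⟩
    ℚΣ.sum (λ i → f i + g i)   ≡⟨ ℚΣ.∑-distrib-+ f g ⟩
    ℚΣ.sum f + ℚΣ.sum g        ≡⟨ sym (cong₂ _+_ (sumFin≡∑ n f) (sumFin≡∑ n g)) ⟩
    sumFin n f + sumFin n g    ∎
    where open ≡-Reasoning

  sumFin-neg : ∀ n (f : Fin n → ℚ) → sumFin n (λ i → - f i) ≡ - sumFin n f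
  sumFin-neg zero    f = refl
  sumFin-neg (suc n) f = trans (cong (- f zero +_) (sumFin-neg n (f ∘ suc))) (sym (ℚP.neg-distrib-+ (f zero) _))

  sumFin-scale : ∀ n q (f : Fin n → ℚ) → sumFin n (λ i → q * f i) ≡ q * sumFin n f
  sumFin-scale n q f = begin
    sumFin n (λ i → q * f i) ≡⟨ sumFin≡∑ n _ ⟩
    ℚΣ.sum (λ i → q * f i)   ≡⟨ sym (ℚΣ.*-distribˡ-sum q f) ⟩
    q * ℚΣ.sum f             ≡⟨ cong (q *_) (sym (sumFin≡∑ n f)) ⟩
    q * sumFin n f           ∎
    where open ≡-Reasoning

  sumFin-comm : ∀ m n (f : Fin m → Fin n → ℚ) →
    sumFin m (λ i → sumFin n (f i)) ≡ sumFin n (λ j → sumFin m (λ i → f i j))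
  sumFin-comm m n f = begin
    sumFin m (λ i → sumFin n (f i))          ≡⟨ sumFin≡∑ m _ ⟩
    ℚΣ.sum (λ i → sumFin n (f i))            ≡⟨ ℚΣ.sum-cong-≗ (λ i → sumFin≡∑ n (f i)) ⟩
    ℚΣ.sum (λ i → ℚΣ.sum (f i))              ≡⟨ ℚΣ.∑-comm f ⟩
    ℚΣ.sum (λ j → ℚΣ.sum (λ i → f i j))      ≡⟨ ℚΣ.sum-cong-≗ (λ j → sym (sumFin≡∑ m (λ i → f i j))) ⟩
    ℚΣ.sum (λ j → sumFin m (λ i → f i j))    ≡⟨ sym (sumFin≡∑ n _) ⟩
    sumFin n (λ j → sumFin m (λ i → f i j))  ∎
    where open ≡-Reasoning

  unit-diag : ∀ {k} (a : Fin k) → unit a a ≡ 1ℚ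
  unit-diag a rewrite dec-true (a ≟ a) refl = refl

  unit-offdiag : ∀ {k} {a j : Fin k} → j ≢ a → unit a j ≡ 0ℚ
  unit-offdiag {a = a} {j} j≢a rewrite dec-false (j ≟ a) j≢a = refl

  sumFin-unit : ∀ k (a : Fin k) → sumFin k (unit a) ≡ 1ℚ
  sumFin-unit k a = trans (sumFin-supportedAt k a (λ j → unit-offdiag)) (unit-diag a)

  sumFin-content : ∀ {k} (e : DiffEq k) → sumFin k (content e) ≡ 0ℚ
  sumFin-content {k} (diffEq a b c d _) = begin
    sumFin k (λ j → unit a j - unit b j - unit c j + unit d j)
      ≡⟨ sumFin-+ k _ (unit d) ⟩
    sumFin k (λ j → unit a j - unit b j - unit c j) + Σ d
      ≡⟨ cong (_+ Σ d) (trans (sumFin-+ k _ _) (cong₂ _+_ (sumFin-+ k (unit a) _) (sumFin-neg k (unit c)))) ⟩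
    Σ a + sumFin k (λ j → - unit b j) - Σ c + Σ d
      ≡⟨ cong (λ x → Σ a + x - Σ c + Σ d) (sumFin-neg k (unit b)) ⟩
    Σ a - Σ b - Σ c + Σ d
      ≡⟨ cong₂ (λ x y → x - y - Σ c + Σ d) (sumFin-unit k a) (sumFin-unit k b) ⟩
    1ℚ - 1ℚ - Σ c + Σ d
      ≡⟨ cong₂ (λ x y → 1ℚ - 1ℚ - x + y) (sumFin-unit k c) (sumFin-unit k d) ⟩
    0ℚ ∎
    where
    open ≡-Reasoning
    Σ : Fin k → ℚ
    Σ x = sumFin k (unit x)

  sumFin-lincomb : ∀ {k t} (𝒯 : Fin t → DiffEq k) c → sumFin k (lincomb 𝒯 c) ≡ 0ℚ
  sumFin-lincomb {k} {t} 𝒯 c = begin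
    sumFin k (λ j → sumFin t (λ i → c i * content (𝒯 i) j)) ≡⟨ sym (sumFin-comm t k _) ⟩
    sumFin t (λ i → sumFin k (λ j → c i * content (𝒯 i) j)) ≡⟨ sumFin-zero t vanishes ⟩
    0ℚ                                                      ∎
    where
    open ≡-Reasoning
    vanishes : ∀ i → sumFin k (λ j → c i * content (𝒯 i) j) ≡ 0ℚ
    vanishes i = trans (sumFin-scale k (c i) (content (𝒯 i)))
                       (trans (cong (c i *_) (sumFin-content (𝒯 i))) (ℚP.*-zeroʳ (c i)))

  content-outside : ∀ {k} (e : DiffEq k) {j} → j ≢ DiffEq.i₁ e → j ≢ DiffEq.i₂ e →
    j ≢ DiffEq.i₃ e → j ≢ DiffEq.i₄ e → content e j ≡ 0ℚ
  content-outside (diffEq a b c d _) j≢a j≢b j≢c j≢d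
    rewrite unit-offdiag j≢a | unit-offdiag j≢b | unit-offdiag j≢c | unit-offdiag j≢d = refl

  lincomb-single : ∀ {k t} (𝒯 : Fin t → DiffEq k) c j i₀ →
    (∀ i → i ≢ i₀ → content (𝒯 i) j ≡ 0ℚ) → lincomb 𝒯 c j ≡ c i₀ * content (𝒯 i₀) j
  lincomb-single {t = t} 𝒯 c j i₀ absent = sumFin-supportedAt t i₀ λ i i≢i₀ →
    trans (cong (c i *_) (absent i i≢i₀)) (ℚP.*-zeroʳ (c i))

  lincomb-vanishes : ∀ {k t} (𝒯 : Fin t → DiffEq k) c j →
    (∀ i → c i ≡ 0ℚ ⊎ content (𝒯 i) j ≡ 0ℚ) → lincomb 𝒯 c j ≡ 0ℚ
  lincomb-vanishes {t = t} 𝒯 c j vanish = sumFin-zero t λ i → case (vanish i)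
    where
    case : ∀ {i} → c i ≡ 0ℚ ⊎ content (𝒯 i) j ≡ 0ℚ → c i * content (𝒯 i) j ≡ 0ℚ
    case {i} (inj₁ cᵢ≡0) = trans (cong (_* content (𝒯 i) j) cᵢ≡0) (ℚP.*-zeroˡ (content (𝒯 i) j))
    case {i} (inj₂ x≡0)  = trans (cong (c i *_) x≡0) (ℚP.*-zeroʳ (c i))

  lincomb-+ : ∀ {k t} (𝒯 : Fin t → DiffEq k) c d j →
    lincomb 𝒯 (λ i → c i + d i) j ≡ lincomb 𝒯 c j + lincomb 𝒯 d j
  lincomb-+ {t = t} 𝒯 c d j =
    trans (sumFin-cong t (λ i → ℚP.*-distribʳ-+ (content (𝒯 i) j) (c i) (d i))) (sumFin-+ t _ _)

  lincomb-scale : ∀ {k t} (𝒯 : Fin t → DiffEq k) q c j → lincomb 𝒯 (λ i → q * c i) j ≡ q * lincomb 𝒯 c j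
  lincomb-scale {t = t} 𝒯 q c j =
    trans (sumFin-cong t (λ i → ℚP.*-assoc q (c i) (content (𝒯 i) j))) (sumFin-scale t q _)

  supportedOnPair : ∀ {k} {f : LinForm k} {a b} → b ≢ a → (∀ j → j ≢ a → j ≢ b → f j ≡ 0ℚ) →
    ∀ j → f j ≡ f a * unit a j + f b * unit b j
  supportedOnPair {f = f} {a} {b} b≢a outside j with j ≟ a
  ... | yes refl rewrite unit-offdiag (b≢a ∘ sym) =
    sym (trans (cong₂ _+_ (ℚP.*-identityʳ (f j)) (ℚP.*-zeroʳ (f b))) (ℚP.+-identityʳ (f j)))
  ... | no j≢a with j ≟ b
  ...   | yes refl = sym (trans (cong₂ _+_ (ℚP.*-zeroʳ (f a)) (ℚP.*-identityʳ (f j))) (ℚP.+-identityˡ (f j)))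
  ...   | no j≢b rewrite outside j j≢a j≢b = sym (cong₂ _+_ (ℚP.*-zeroʳ (f a)) (ℚP.*-zeroʳ (f b)))

  zeroSum-supportedOnPair : ∀ {k} {f : LinForm k} {a b} → b ≢ a → sumFin k f ≡ 0ℚ →
    (∀ j → j ≢ a → j ≢ b → f j ≡ 0ℚ) → ∀ j → f j ≡ f a * (unit a j - unit b j)
  zeroSum-supportedOnPair {k} {f} {a} {b} b≢a Σf≡0 outside j = begin
    f j                                 ≡⟨ on-pair j ⟩
    f a * unit a j + f b * unit b j     ≡⟨ cong (λ y → f a * unit a j + y * unit b j) fb≡-fa ⟩
    f a * unit a j + - f a * unit b j   ≡⟨ cong (f a * unit a j +_) (ℚP.neg-distribˡ-* (f a) (unit b j)) ⟨
    f a * unit a j + - (f a * unit b j) ≡⟨ cong (f a * unit a j +_) (ℚP.neg-distribʳ-* (f a) (unit b j)) ⟩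
    f a * unit a j + f a * - unit b j   ≡⟨ ℚP.*-distribˡ-+ (f a) (unit a j) (- unit b j) ⟨
    f a * (unit a j - unit b j)         ∎
    where
    open ≡-Reasoning
    on-pair : ∀ j → f j ≡ f a * unit a j + f b * unit b j
    on-pair = supportedOnPair b≢a outside
    fa+fb≡0 : f a + f b ≡ 0ℚ
    fa+fb≡0 = begin
      f a + f b                                          ≡⟨ cong₂ _+_ (ℚP.*-identityʳ (f a)) (ℚP.*-identityʳ (f b)) ⟨
      f a * 1ℚ + f b * 1ℚ                                ≡⟨ cong₂ (λ x y → f a * x + f b * y) (sumFin-unit k a) (sumFin-unit k b) ⟨
      f a * sumFin k (unit a) + f b * sumFin k (unit b)  ≡⟨ cong₂ _+_ (sumFin-scale k (f a) (unit a)) (sumFin-scale k (f b) (unit b)) ⟨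
      sumFin k (λ j → f a * unit a j) + sumFin k (λ j → f b * unit b j) ≡⟨ sumFin-+ k _ _ ⟨
      sumFin k (λ j → f a * unit a j + f b * unit b j)   ≡⟨ sumFin-cong k on-pair ⟨
      sumFin k f                                         ≡⟨ Σf≡0 ⟩
      0ℚ                                                 ∎
    fb≡-fa : f b ≡ - f a
    fb≡-fa = inverseʳ-unique (f a) (f b) fa+fb≡0

  module _ {k t} (𝒯 : Fin t → DiffEq k) (d : Fin t → ℚ) where

    private
      G : LinForm k
      G = lincomb 𝒯 d

    rescale-to-difference : ∀ {a b} (Ga≢0 : G a ≢ 0ℚ) → (∀ j → G j ≡ G a * (unit a j - unit b j)) →
      ImpliesForm 𝒯 ⊤ (λ j → unit a j - unit b j)
    rescale-to-difference {a} {b} Ga≢0 G≡ = (λ i → g⁻¹ * d i) , (λ i i∉⊤ → ⊥-elim (i∉⊤ ∈⊤)) , λ j → begin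
      lincomb 𝒯 (λ i → g⁻¹ * d i) j         ≡⟨ lincomb-scale 𝒯 g⁻¹ d j ⟩
      g⁻¹ * G j                             ≡⟨ cong (g⁻¹ *_) (G≡ j) ⟩
      g⁻¹ * (G a * (unit a j - unit b j))   ≡⟨ ℚP.*-assoc g⁻¹ (G a) _ ⟨
      g⁻¹ * G a * (unit a j - unit b j)     ≡⟨ cong (_* (unit a j - unit b j)) (ℚP.*-inverseˡ (G a) {{≢-nonZero Ga≢0}}) ⟩
      1ℚ * (unit a j - unit b j)            ≡⟨ ℚP.*-identityˡ _ ⟩
      unit a j - unit b j                   ∎
      where
      open ≡-Reasoning
      g⁻¹ : ℚ
      g⁻¹ = (1/ G a) {{≢-nonZero Ga≢0}}

    -- An implied form has coefficient sum zero, so on two variables a, b it is a multiple of x_a − x_b.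
    Valid⇒support≥3 : Valid 𝒯 → ∀ {a} → G a ≢ 0ℚ → 3 ≤ℕ countB k (nonzero? ∘ G)
    Valid⇒support≥3 valid {a} Ga≢0 with 3 ≤? countB k (nonzero? ∘ G)
    ... | yes 3≤ = 3≤
    ... | no 3≰ with FinP.any? (λ b → ¬? (b ≟ a) ×-dec ¬? (G b ℚP.≟ 0ℚ))
    ...   | no ∄b = ⊥-elim (Ga≢0 (trans (sym (sumFin-supportedAt k a vanishes)) (sumFin-lincomb 𝒯 d)))
      where
      vanishes : ∀ j → j ≢ a → G j ≡ 0ℚ
      vanishes j j≢a = decidable-stable (G j ℚP.≟ 0ℚ) λ Gj≢0 → ∄b (j , j≢a , Gj≢0)
    ...   | yes (b , b≢a , Gb≢0) = ⊥-elim (valid a b (b≢a ∘ sym) (rescale-to-difference Ga≢0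
              (zeroSum-supportedOnPair b≢a (sumFin-lincomb 𝒯 d) vanishes)))
      where
      vanishes : ∀ j → j ≢ a → j ≢ b → G j ≡ 0ℚ
      vanishes j j≢a j≢b = decidable-stable (G j ℚP.≟ 0ℚ) λ Gj≢0 →
        3≰ (countB-≥3 k (nonzero? ∘ G) b≢a j≢a j≢b
              (nonzero?-complete Ga≢0) (nonzero?-complete Gb≢0) (nonzero?-complete Gj≢0))

  minimal-coefficients≢0 : ∀ {k t} {𝒯 : Fin t → DiffEq k} {E c} → (∀ S → S ⊂ ⊤ → ¬ Implies 𝒯 S E) →
    (∀ j → lincomb 𝒯 c j ≡ content E j) → ∀ i → c i ≢ 0ℚ
  minimal-coefficients≢0 {c = c} minimal 𝒯⇒E i cᵢ≡0 =
    minimal (∁ ⁅ i ⁆) ((λ _ → ∈⊤) , i , ∈⊤ , x∈p⇒x∉∁p (x∈⁅x⁆ i)) (c , vanishes , 𝒯⇒E)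
    where
    vanishes : ∀ i′ → i′ ∉ ∁ ⁅ i ⁆ → c i′ ≡ 0ℚ
    vanishes i′ i′∉ rewrite x∈⁅y⁆⇒x≡y i (x∉∁p⇒x∈p i′∉) = cᵢ≡0

module Incidence where

  open import Data.Nat using (ℕ; zero; suc; _+_; _*_; _≤_)
  import Data.Nat.Properties as ℕP
  open import Data.Nat.Tactic.RingSolver using (solve-∀)
  open Counting
  open import Data.Rational using (0ℚ)
  open LinearForms using (nonzero?-sound; content-outside)

  countB-appears≤4 : ∀ {k} (e : DiffEq k) → countB k (λ j → appearsB j e) ≤ 4
  countB-appears≤4 {k} e@(diffEq a b c d _) = begin
    countB k (λ j → appearsB j e)                                        ≤⟨ countB-mono appears⇒endpoint ⟩
    countB k (λ j → ((is a j ∨ is b j) ∨ is c j) ∨ is d j)               ≤⟨ countB-∨ k _ (is d) ⟩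
    countB k (λ j → (is a j ∨ is b j) ∨ is c j) + countB k (is d)        ≤⟨ ℕP.+-monoˡ-≤ _ (countB-∨ k _ (is c)) ⟩
    countB k (λ j → is a j ∨ is b j) + countB k (is c) + countB k (is d) ≤⟨ ℕP.+-monoˡ-≤ _ (ℕP.+-monoˡ-≤ _ (countB-∨ k (is a) (is b))) ⟩
    countB k (is a) + countB k (is b) + countB k (is c) + countB k (is d)
      ≡⟨ cong₂ _+_ (cong₂ _+_ (cong₂ _+_ (countB-≟ k a) (countB-≟ k b)) (countB-≟ k c)) (countB-≟ k d) ⟩
    4                                                                     ∎
    where
    open ℕP.≤-Reasoning
    is : Fin k → Fin k → Bool
    is x j = does (j ≟ x)
    endpoint-or-absent : ∀ j → (((is a j ∨ is b j) ∨ is c j) ∨ is d j) ≡ true ⊎ content e j ≡ 0ℚ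
    endpoint-or-absent j = decide (j ≟ a) (j ≟ b) (j ≟ c) (j ≟ d)
      where
      decide : (j≟a : Dec (j ≡ a)) (j≟b : Dec (j ≡ b)) (j≟c : Dec (j ≡ c)) (j≟d : Dec (j ≡ d)) →
        (((does j≟a ∨ does j≟b) ∨ does j≟c) ∨ does j≟d) ≡ true ⊎ content e j ≡ 0ℚ
      decide (yes _)   _         _         _         = inj₁ refl
      decide (no _)    (yes _)   _         _         = inj₁ refl
      decide (no _)    (no _)    (yes _)   _         = inj₁ refl
      decide (no _)    (no _)    (no _)    (yes _)   = inj₁ refl
      decide (no j≢a)  (no j≢b)  (no j≢c)  (no j≢d)  = inj₂ (content-outside e j≢a j≢b j≢c j≢d)
    appears⇒endpoint : ∀ j → appearsB j e ≡ true → (((is a j ∨ is b j) ∨ is c j) ∨ is d j) ≡ true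
    appears⇒endpoint j nz with endpoint-or-absent j
    ... | inj₁ endpoint = endpoint
    ... | inj₂ absent   = ⊥-elim (nonzero?-sound nz absent)

  ∣tabulate∣≡countB : ∀ n (b : Fin n → Bool) → ∣ tabulate {n = n} b ∣ ≡ countB n b
  ∣tabulate∣≡countB zero    b = refl
  ∣tabulate∣≡countB (suc n) b with b zero
  ... | true  = cong suc (∣tabulate∣≡countB n (b ∘ suc))
  ... | false = ∣tabulate∣≡countB n (b ∘ suc)

  ∣S∣≡countB : ∀ n (S : Subset n) → ∣ S ∣ ≡ countB n (lookup S)
  ∣S∣≡countB zero    []          = refl
  ∣S∣≡countB (suc n) (true ∷ S)  = cong suc (∣S∣≡countB n S)
  ∣S∣≡countB (suc n) (false ∷ S) = ∣S∣≡countB n S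

  ∑-countB-comm : ∀ m n (R : Fin m → Fin n → Bool) →
    ℕΣ.sum (λ j → countB m (λ i → R i j)) ≡ ℕΣ.sum (λ i → countB n (R i))
  ∑-countB-comm m n R = begin
    ℕΣ.sum (λ j → countB m (λ i → R i j))       ≡⟨ ℕΣ.sum-cong-≗ (λ j → countB≡∑ m (λ i → R i j)) ⟩
    ℕΣ.sum (λ j → ℕΣ.sum (λ i → 𝟙 (R i j)))     ≡⟨ ℕΣ.∑-comm (λ j i → 𝟙 (R i j)) ⟩
    ℕΣ.sum (λ i → ℕΣ.sum (λ j → 𝟙 (R i j)))     ≡⟨ ℕΣ.sum-cong-≗ (λ i → countB≡∑ n (R i)) ⟨
    ℕΣ.sum (λ i → countB n (R i))               ∎
    where open ≡-Reasoning

  appearsInB-intro : ∀ {k t} (𝒯 : Fin t → DiffEq k) S {i j} →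
    lookup S i ≡ true → appearsB j (𝒯 i) ≡ true → appearsInB 𝒯 S j ≡ true
  appearsInB-intro 𝒯 S {zero} Sᵢ aᵢ rewrite Sᵢ | aᵢ = refl
  appearsInB-intro 𝒯 S {suc i} {j} Sᵢ aᵢ =
    trans (cong (lookup S zero ∧ appearsB j (𝒯 zero) ∨_)
                (appearsInB-intro (𝒯 ∘ suc) _ (trans (lookup∘tabulate _ i) Sᵢ) aᵢ))
          (BoolP.∨-zeroʳ _)

  private
    ∧-true⁻ : ∀ {x y} → x ∧ y ≡ true → x ≡ true × y ≡ true
    ∧-true⁻ {true} {true} _ = refl , refl

  appearsInB-elim : ∀ {k t} (𝒯 : Fin t → DiffEq k) S {j} →
    appearsInB 𝒯 S j ≡ true → ∃ λ i → lookup S i ≡ true × appearsB j (𝒯 i) ≡ true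
  appearsInB-elim {t = suc t} 𝒯 S {j} inS with lookup S zero ∧ appearsB j (𝒯 zero) in here
  ... | true  = zero , ∧-true⁻ here
  ... | false with appearsInB-elim (𝒯 ∘ suc) (tabulate (lookup S ∘ suc)) inS
  ...   | i , Sᵢ , aᵢ = suc i , trans (sym (lookup∘tabulate (lookup S ∘ suc) i)) Sᵢ , aᵢ

  incidences : ∀ {k t} → (Fin t → DiffEq k) → Subset t → Fin k → ℕ
  incidences {t = t} 𝒯 S j = countB t (λ i → lookup S i ∧ appearsB j (𝒯 i))

  ∑-incidences≤4∣S∣ : ∀ {k t} (𝒯 : Fin t → DiffEq k) S → ℕΣ.sum (incidences 𝒯 S) ≤ 4 * ∣ S ∣
  ∑-incidences≤4∣S∣ {k} {t} 𝒯 S = begin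
    ℕΣ.sum (incidences 𝒯 S)                                  ≡⟨ ∑-countB-comm t k (λ i j → lookup S i ∧ appearsB j (𝒯 i)) ⟩
    ℕΣ.sum (λ i → countB k (λ j → lookup S i ∧ appearsB j (𝒯 i))) ≤⟨ ∑-mono-≤ (λ i → size-if-in (lookup S i) (𝒯 i)) ⟩
    ℕΣ.sum (λ i → 4 * 𝟙 (lookup S i))                        ≡⟨ ℕΣ.*-distribˡ-sum 4 (𝟙 ∘ lookup S) ⟨
    4 * ℕΣ.sum (𝟙 ∘ lookup S)                                ≡⟨ cong (4 *_) (trans (∣S∣≡countB t S) (countB≡∑ t (lookup S))) ⟨
    4 * ∣ S ∣                                                ∎
    where
    open ℕP.≤-Reasoning
    size-if-in : ∀ s e → countB k (λ j → s ∧ appearsB j e) ≤ 4 * 𝟙 s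
    size-if-in true  e = countB-appears≤4 e
    size-if-in false e = ℕP.≤-reflexive (countB-false k)

  occurrences≡ : ∀ {k t} (𝒯 : Fin t → DiffEq k) E j →
    occurrences 𝒯 E j ≡ 𝟙 (appearsB j E) + incidences 𝒯 ⊤ j
  occurrences≡ 𝒯 E j = cong (𝟙 (appearsB j E) +_)
    (countB-cong (λ i → cong (_∧ appearsB j (𝒯 i)) (sym (lookup-replicate i true))))

  ∑-occurrences≤ : ∀ {k t} (𝒯 : Fin t → DiffEq k) E → ℕΣ.sum (occurrences 𝒯 E) ≤ 2 * (2 * t + 2)
  ∑-occurrences≤ {k} {t} 𝒯 E = begin
    ℕΣ.sum (occurrences 𝒯 E)                                   ≡⟨ ℕΣ.sum-cong-≗ (occurrences≡ 𝒯 E) ⟩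
    ℕΣ.sum (λ j → 𝟙 (appearsB j E) + incidences 𝒯 ⊤ j)         ≡⟨ ℕΣ.∑-distrib-+ _ (incidences 𝒯 ⊤) ⟩
    ℕΣ.sum (λ j → 𝟙 (appearsB j E)) + ℕΣ.sum (incidences 𝒯 ⊤)  ≡⟨ cong (_+ _) (countB≡∑ k (λ j → appearsB j E)) ⟨
    countB k (λ j → appearsB j E) + ℕΣ.sum (incidences 𝒯 ⊤)    ≤⟨ ℕP.+-mono-≤ (countB-appears≤4 E) (∑-incidences≤4∣S∣ 𝒯 ⊤) ⟩
    4 + 4 * ∣ ⊤ {t} ∣                                          ≡⟨ cong (λ n → 4 + 4 * n) (∣⊤∣≡n t) ⟩
    4 + 4 * t                                                  ≡⟨ 4+4n≡2[2n+2] t ⟩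
    2 * (2 * t + 2)                                            ∎
    where
    open ℕP.≤-Reasoning
    4+4n≡2[2n+2] : ∀ n → 4 + 4 * n ≡ 2 * (2 * n + 2)
    4+4n≡2[2n+2] = solve-∀

module MinimalImplication {k t} {𝒯 : Fin t → DiffEq k} {E : DiffEq k} {c : Fin t → ℚ}
  (𝒯⇒E : ∀ j → lincomb 𝒯 c j ≡ content E j) (c≢0 : ∀ i → c i ≢ 0ℚ) where

  open import Data.Nat using (ℕ; suc; _+_; _*_; _≤_; z≤n; s≤s; _≤?_)
  import Data.Nat.Properties as ℕP
  open import Data.Nat.Tactic.RingSolver using (solve-∀)
  import Data.Rational.Properties as ℚP
  open Counting
  open Incidence
  open LinearForms

  -- Otherwise x_j would keep the coefficient c i₀ · content (𝒯 i₀) j ≠ 0 in the content of E.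
  appears-twice : ∀ (P : Fin t → Bool) {i₀ j} → (∀ i → appearsB j (𝒯 i) ≡ true → P i ≡ true) →
    appearsB j E ≡ false → P i₀ ≡ true → appearsB j (𝒯 i₀) ≡ true →
    2 ≤ countB t (λ i → P i ∧ appearsB j (𝒯 i))
  appears-twice P {i₀} {j} covers j∉E Pᵢ₀ aᵢ₀ with 2 ≤? countB t (λ i → P i ∧ appearsB j (𝒯 i))
  ... | yes 2≤ = 2≤
  ... | no 2≰ = ⊥-elim (*-≢0 (c≢0 i₀) (nonzero?-sound aᵢ₀) (begin
    c i₀ ℚ.* content (𝒯 i₀) j  ≡⟨ lincomb-single 𝒯 c j i₀ only-i₀ ⟨
    lincomb 𝒯 c j             ≡⟨ 𝒯⇒E j ⟩
    content E j               ≡⟨ nonzero?-false j∉E ⟩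
    0ℚ                        ∎))
    where
    open ≡-Reasoning
    only-i₀ : ∀ i → i ≢ i₀ → content (𝒯 i) j ≡ 0ℚ
    only-i₀ i i≢i₀ with appearsB j (𝒯 i) in aᵢ
    ... | false = nonzero?-false aᵢ
    ... | true  = ⊥-elim (2≰ (countB-≥2 t _ i≢i₀ (cong₂ _∧_ Pᵢ₀ aᵢ₀) (cong₂ _∧_ (covers i aᵢ) aᵢ)))

  occurrences≥2 : ∀ {j} → appearsInB 𝒯 ⊤ j ≡ true → 2 ≤ occurrences 𝒯 E j
  occurrences≥2 {j} j∈𝒯 with appearsInB-elim 𝒯 ⊤ j∈𝒯
  ... | i₀ , _ , aᵢ₀ with appearsB j E in j∈E
  ...   | true  = s≤s (countB-≥1 t _ aᵢ₀)
  ...   | false = appears-twice (λ _ → true) {i₀} {j} (λ _ _ → refl) j∈E refl aᵢ₀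

  twice-indicator≤occurrences : ∀ j → 2 * 𝟙 (appearsInB 𝒯 ⊤ j) ≤ occurrences 𝒯 E j
  twice-indicator≤occurrences j with appearsInB 𝒯 ⊤ j in j∈𝒯
  ... | true  = occurrences≥2 j∈𝒯
  ... | false = z≤n

  twice-∣varsIn∣ : 2 * ∣ varsIn 𝒯 ⊤ ∣ ≡ ℕΣ.sum (λ j → 2 * 𝟙 (appearsInB 𝒯 ⊤ j))
  twice-∣varsIn∣ = trans (cong (2 *_) (trans (∣tabulate∣≡countB k _) (countB≡∑ k _)))
                         (ℕΣ.*-distribˡ-sum 2 (𝟙 ∘ appearsInB 𝒯 ⊤))

  twice-∣varsIn∣≤∑occurrences : 2 * ∣ varsIn 𝒯 ⊤ ∣ ≤ ℕΣ.sum (occurrences 𝒯 E)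
  twice-∣varsIn∣≤∑occurrences =
    ℕP.≤-trans (ℕP.≤-reflexive twice-∣varsIn∣) (∑-mono-≤ twice-indicator≤occurrences)

  ∣varsIn∣≤2t+2 : ∣ varsIn 𝒯 ⊤ ∣ ≤ 2 * t + 2
  ∣varsIn∣≤2t+2 = ℕP.*-cancelˡ-≤ 2 (begin
    2 * ∣ varsIn 𝒯 ⊤ ∣             ≤⟨ twice-∣varsIn∣≤∑occurrences ⟩
    ℕΣ.sum (occurrences 𝒯 E)      ≤⟨ ∑-occurrences≤ 𝒯 E ⟩
    2 * (2 * t + 2)               ∎)
    where open ℕP.≤-Reasoning

  ∣varsIn∣≡2t+2⇒occurrences≡2 : ∣ varsIn 𝒯 ⊤ ∣ ≡ 2 * t + 2 → ∀ j → j ∈ varsIn 𝒯 ⊤ → occurrences 𝒯 E j ≡ 2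
  ∣varsIn∣≡2t+2⇒occurrences≡2 ∣V∣≡ j j∈V = begin
    occurrences 𝒯 E j                ≡⟨ ∑-tight twice-indicator≤occurrences ∑occ≤ j ⟨
    2 * 𝟙 (appearsInB 𝒯 ⊤ j)         ≡⟨ cong (λ b → 2 * 𝟙 b) (trans (sym (lookup∘tabulate _ j)) ([]=⇒lookup j∈V)) ⟩
    2                                ∎
    where
    open ≡-Reasoning
    ∑occ≤ : ℕΣ.sum (occurrences 𝒯 E) ≤ ℕΣ.sum (λ j → 2 * 𝟙 (appearsInB 𝒯 ⊤ j))
    ∑occ≤ = ℕP.≤-trans (∑-occurrences≤ 𝒯 E) (ℕP.≤-reflexive
      (trans (cong (2 *_) (sym ∣V∣≡)) twice-∣varsIn∣))

  module ProperSubcollection (valid : Valid 𝒯) (indep : LinIndep 𝒯) (S : Subset t) {i₁} (i₁∉S : i₁ ∉ S) where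

    only shared : Fin k → Bool
    only   j = appearsInB 𝒯 S j ∧ not (appearsInB 𝒯 (∁ S) j)
    shared j = appearsInB 𝒯 S j ∧ appearsInB 𝒯 (∁ S) j

    covered-by-S : ∀ {j} → appearsInB 𝒯 (∁ S) j ≡ false → ∀ i → appearsB j (𝒯 i) ≡ true → lookup S i ≡ true
    covered-by-S j∉∁S i aᵢ with lookup S i in Sᵢ
    ... | true  = refl
    ... | false with () ← trans (sym (appearsInB-intro 𝒯 (∁ S) (trans (lookup-map i not S) (cong not Sᵢ)) aᵢ)) j∉∁S

    only-shared-bound : ∀ j → 2 * 𝟙 (only j) + 𝟙 (shared j) ≤ incidences 𝒯 S j + 𝟙 (only j ∧ appearsB j E)
    only-shared-bound j with appearsInB 𝒯 S j in j∈S
    ... | false = z≤n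
    ... | true with appearsInB-elim 𝒯 S j∈S
    ...   | i₀ , Sᵢ₀ , aᵢ₀ with appearsInB 𝒯 (∁ S) j in j∈∁S | appearsB j E in j∈E
    ...     | true  | _     = ℕP.≤-trans (countB-≥1 t _ (cong₂ _∧_ Sᵢ₀ aᵢ₀)) (ℕP.m≤m+n _ _)
    ...     | false | true  = ℕP.+-monoˡ-≤ 1 (countB-≥1 t _ (cong₂ _∧_ Sᵢ₀ aᵢ₀))
    ...     | false | false = ℕP.≤-trans (appears-twice (lookup S) {i₀} {j} (covered-by-S j∈∁S) j∈E Sᵢ₀ aᵢ₀)
                                         (ℕP.m≤m+n _ _)

    c↾∁S c↾S : Fin t → ℚ
    c↾∁S i = if lookup S i then 0ℚ else c i
    c↾S  i = if lookup S i then c i else 0ℚ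

    complementForm : LinForm k
    complementForm = lincomb 𝒯 c↾∁S

    complementForm+restriction : ∀ j → complementForm j ℚ.+ lincomb 𝒯 c↾S j ≡ content E j
    complementForm+restriction j = begin
      complementForm j ℚ.+ lincomb 𝒯 c↾S j      ≡⟨ lincomb-+ 𝒯 c↾∁S c↾S j ⟨
      lincomb 𝒯 (λ i → c↾∁S i ℚ.+ c↾S i) j      ≡⟨ sumFin-cong t (λ i → cong (ℚ._* content (𝒯 i) j) (recombine i)) ⟩
      lincomb 𝒯 c j                             ≡⟨ 𝒯⇒E j ⟩
      content E j                               ∎
      where
      open ≡-Reasoning
      recombine : ∀ i → c↾∁S i ℚ.+ c↾S i ≡ c i
      recombine i with lookup S i
      ... | true  = ℚP.+-identityˡ (c i)
      ... | false = ℚP.+-identityʳ (c i)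

    complementForm-vanishes : ∀ {j} → appearsInB 𝒯 (∁ S) j ≡ false → complementForm j ≡ 0ℚ
    complementForm-vanishes {j} j∉∁S = lincomb-vanishes 𝒯 c↾∁S j vanishes
      where
      vanishes : ∀ i → c↾∁S i ≡ 0ℚ ⊎ content (𝒯 i) j ≡ 0ℚ
      vanishes i with lookup S i in Sᵢ | appearsB j (𝒯 i) in aᵢ
      ... | true  | _     = inj₁ refl
      ... | false | false = inj₂ (nonzero?-false aᵢ)
      ... | false | true  with () ← trans (sym (covered-by-S j∉∁S i aᵢ)) Sᵢ

    restriction-vanishes : ∀ {j} → appearsInB 𝒯 S j ≡ false → lincomb 𝒯 c↾S j ≡ 0ℚ
    restriction-vanishes {j} j∉S = lincomb-vanishes 𝒯 c↾S j vanishes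
      where
      vanishes : ∀ i → c↾S i ≡ 0ℚ ⊎ content (𝒯 i) j ≡ 0ℚ
      vanishes i with lookup S i in Sᵢ | appearsB j (𝒯 i) in aᵢ
      ... | false | _     = inj₁ refl
      ... | true  | false = inj₂ (nonzero?-false aᵢ)
      ... | true  | true  with () ← trans (sym (appearsInB-intro 𝒯 S Sᵢ aᵢ)) j∉S

    complementForm-support : ∀ j → nonzero? (complementForm j) ≡ true →
      (shared j ∨ (not (only j) ∧ appearsB j E)) ≡ true
    complementForm-support j nz with appearsInB 𝒯 (∁ S) j in j∈∁S
    ... | false = ⊥-elim (nonzero?-sound nz (complementForm-vanishes j∈∁S))
    ... | true with appearsInB 𝒯 S j in j∈S
    ...   | true  = refl
    ...   | false = nonzero?-complete λ Eⱼ≡0 → nonzero?-sound nz (begin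
      complementForm j                          ≡⟨ ℚP.+-identityʳ _ ⟨
      complementForm j ℚ.+ 0ℚ                   ≡⟨ cong (complementForm j ℚ.+_) (restriction-vanishes j∈S) ⟨
      complementForm j ℚ.+ lincomb 𝒯 c↾S j      ≡⟨ complementForm+restriction j ⟩
      content E j                               ≡⟨ Eⱼ≡0 ⟩
      0ℚ                                        ∎)
      where open ≡-Reasoning

    complementForm-nonzero : ∃ λ j → complementForm j ≢ 0ℚ
    complementForm-nonzero = FinP.¬∀⟶∃¬ k _ (λ j → complementForm j ℚP.≟ 0ℚ) λ F≡0 →
      c≢0 i₁ (subst (λ b → (if b then 0ℚ else c i₁) ≡ 0ℚ) i₁∉S′ (indep c↾∁S F≡0 i₁))
      where
      i₁∉S′ : lookup S i₁ ≡ false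
      i₁∉S′ = BoolP.¬-not (i₁∉S ∘ lookup⇒[]= i₁ S)

    3≤∣shared∣+∣E∖only∣ : 3 ≤ countB k shared + countB k (λ j → not (only j) ∧ appearsB j E)
    3≤∣shared∣+∣E∖only∣ = let j , Fⱼ≢0 = complementForm-nonzero in begin
      3                                                            ≤⟨ Valid⇒support≥3 𝒯 c↾∁S valid {j} Fⱼ≢0 ⟩
      countB k (nonzero? ∘ complementForm)                         ≤⟨ countB-mono complementForm-support ⟩
      countB k (λ j → shared j ∨ (not (only j) ∧ appearsB j E))    ≤⟨ countB-∨ k shared _ ⟩
      countB k shared + countB k (λ j → not (only j) ∧ appearsB j E) ∎
      where open ℕP.≤-Reasoning

    2∣only∣+∣shared∣≤ : 2 * countB k only + countB k shared ≤
                    ℕΣ.sum (incidences 𝒯 S) + countB k (λ j → only j ∧ appearsB j E)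
    2∣only∣+∣shared∣≤ = begin
      2 * countB k only + countB k shared
        ≡⟨ cong₂ _+_ (trans (cong (2 *_) (countB≡∑ k only)) (ℕΣ.*-distribˡ-sum 2 (𝟙 ∘ only))) (countB≡∑ k shared) ⟩
      ℕΣ.sum (λ j → 2 * 𝟙 (only j)) + ℕΣ.sum (𝟙 ∘ shared)
        ≡⟨ ℕΣ.∑-distrib-+ (λ j → 2 * 𝟙 (only j)) (𝟙 ∘ shared) ⟨
      ℕΣ.sum (λ j → 2 * 𝟙 (only j) + 𝟙 (shared j))
        ≤⟨ ∑-mono-≤ only-shared-bound ⟩
      ℕΣ.sum (λ j → incidences 𝒯 S j + 𝟙 (only j ∧ appearsB j E))
        ≡⟨ ℕΣ.∑-distrib-+ (incidences 𝒯 S) (λ j → 𝟙 (only j ∧ appearsB j E)) ⟩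
      ℕΣ.sum (incidences 𝒯 S) + ℕΣ.sum (λ j → 𝟙 (only j ∧ appearsB j E))
        ≡⟨ cong (ℕΣ.sum (incidences 𝒯 S) +_) (countB≡∑ k (λ j → only j ∧ appearsB j E)) ⟨
      ℕΣ.sum (incidences 𝒯 S) + countB k (λ j → only j ∧ appearsB j E) ∎
      where open ℕP.≤-Reasoning

    ∣varsOnlyIn∣≤2∣S∣ : ∣ varsOnlyIn 𝒯 S ∣ ≤ 2 * ∣ S ∣
    ∣varsOnlyIn∣≤2∣S∣ = subst (_≤ 2 * ∣ S ∣) (sym (∣tabulate∣≡countB k only))
      (2v+3≤4s+4⇒v≤2s (countB k only) ∣ S ∣ (begin
        2 * v + 3                         ≤⟨ ℕP.+-monoʳ-≤ (2 * v) 3≤∣shared∣+∣E∖only∣ ⟩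
        2 * v + (w + e∖)                  ≡⟨ ℕP.+-assoc (2 * v) w e∖ ⟨
        2 * v + w + e∖                    ≤⟨ ℕP.+-monoˡ-≤ e∖ 2∣only∣+∣shared∣≤ ⟩
        ℕΣ.sum (incidences 𝒯 S) + e + e∖  ≡⟨ ℕP.+-assoc (ℕΣ.sum (incidences 𝒯 S)) e e∖ ⟩
        ℕΣ.sum (incidences 𝒯 S) + (e + e∖) ≤⟨ ℕP.+-mono-≤ (∑-incidences≤4∣S∣ 𝒯 S) E-split ⟩
        4 * ∣ S ∣ + 4                     ∎))
      where
      open ℕP.≤-Reasoning
      v w e e∖ : ℕ
      v  = countB k only
      w  = countB k shared
      e  = countB k (λ j → only j ∧ appearsB j E)
      e∖ = countB k (λ j → not (only j) ∧ appearsB j E)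
      E-split : e + e∖ ≤ 4
      E-split = subst (_≤ 4) (countB-split k only (λ j → appearsB j E)) (countB-appears≤4 E)
      2v+3≤4s+4⇒v≤2s : ∀ v s → 2 * v + 3 ≤ 4 * s + 4 → v ≤ 2 * s
      2v+3≤4s+4⇒v≤2s v s 2v+3≤ = ℕP.≤-pred (ℕP.*-cancelˡ-< 2 v (suc (2 * s))
        (ℕP.+-cancelʳ-≤ 2 (suc (2 * v)) (2 * suc (2 * s)) (subst₂ _≤_ (left v) (right s) 2v+3≤)))
        where
        left : ∀ v → 2 * v + 3 ≡ suc (2 * v) + 2
        left = solve-∀
        right : ∀ s → 4 * s + 4 ≡ 2 * suc (2 * s) + 2
        right = solve-∀

open import Data.Nat using (ℕ; _+_; _*_; _≤_)
open LinearForms using (minimal-coefficients≢0)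

lemma2p10 : ∀ (k t : ℕ) (𝒯 : Fin t → DiffEq k) (E : DiffEq k) →
    Valid 𝒯 → LinIndep 𝒯 → MinImplies 𝒯 E →
    ((∣ varsIn 𝒯 ⊤ ∣ ≤ 2 * t + 2)
      × (∣ varsIn 𝒯 ⊤ ∣ ≡ 2 * t + 2 →
           ∀ (j : Fin k) → j ∈ varsIn 𝒯 ⊤ → occurrences 𝒯 E j ≡ 2))
    × (∀ (S : Subset t) → S ⊂ ⊤ → ∣ varsOnlyIn 𝒯 S ∣ ≤ 2 * ∣ S ∣)
lemma2p10 k t 𝒯 E valid indep ((c , _ , 𝒯⇒E) , minimal) =
  (∣varsIn∣≤2t+2 , ∣varsIn∣≡2t+2⇒occurrences≡2) ,
  λ { S (_ , _ , _ , i₁∉S) → ProperSubcollection.∣varsOnlyIn∣≤2∣S∣ valid indep S i₁∉S }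
  where open MinimalImplication {𝒯 = 𝒯} {E} {c} 𝒯⇒E (minimal-coefficients≢0 {𝒯 = 𝒯} {E} {c} minimal 𝒯⇒E)
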